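{- Let $H$ be a $3$-connected graph, $uv$ an edge of $H$, and $X\subseteq V(H)\setminus\{u,v\}$ a set with at least $3$ elements. Then for some $x\in\{u,v\}$ there are $(X,\{u,v\})$-paths $\alpha,\beta,\gamma$ of $H$ such that $V(\alpha)\cap V(\gamma)=V(\beta)\cap V(\gamma)=\emptyset$ and $V(\alpha)\cap V(\beta)=\{x\}$.
   Context: Graphs are finite, without loops or parallel edges. For vertex sets $A,B$, an $(A,B)$-path is a path with one end in $A$, the other end in $B$, and no other vertex in $A\cup B$. -}

module Defs where

open import Data.Nat using (ℕ; _<_; _≤_)
open import Data.Bool using (Bool; true; false)
open import Data.Fin using (Fin)
open import Data.Fin.Subset using (Subset; _∈_; _∉_; ∣_∣)
open import Data.List using (List; []; _∷_)
open import Data.List.Relation.Unary.Linked using (Linked)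
open import Data.List.Relation.Unary.All using (All)
open import Data.List.Relation.Unary.Unique.Propositional using (Unique)
import Data.List.Membership.Propositional as LM
open import Data.Product using (Σ; _×_; ∃; ∃-syntax)
open import Data.Sum using (_⊎_)
open import Data.Empty using (⊥)
open import Relation.Binary.PropositionalEquality using (_≡_)
open import Relation.Nullary using (¬_)

record Graph (n : ℕ) : Set where
  field
    adj     : Fin n → Fin n → Bool
    adj-sym : ∀ i j → adj i j ≡ adj j i
    irrefl  : ∀ i → adj i i ≡ false
open Graph public

Adj : ∀ {n} → Graph n → Fin n → Fin n → Set
Adj G i j = adj G i j ≡ true

endL : ∀ {n} → Fin n → List (Fin n) → Fin n
endL x []       = x
endL x (y ∷ ys) = endL y ys

IsPath : ∀ {n} → Graph n → List (Fin n) → Set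
IsPath G []       = ⊥
IsPath G (x ∷ xs) = Linked (Adj G) (x ∷ xs) × Unique (x ∷ xs)

IsPathFromTo : ∀ {n} → Graph n → Fin n → Fin n → List (Fin n) → Set
IsPathFromTo G a b []       = ⊥
IsPathFromTo G a b (x ∷ xs) = IsPath G (x ∷ xs) × x ≡ a × endL x xs ≡ b

ConnectedMinus : ∀ {n} → Graph n → Subset n → Set
ConnectedMinus {n} G S =
  (Σ (Fin n) λ w → w ∉ S) ×
  (∀ a b → a ∉ S → b ∉ S →
     Σ (List (Fin n)) λ p → IsPathFromTo G a b p × All (λ w → w ∉ S) p)

-- k-connected (Diestel): more than k vertices, and G - S connected whenever |S| < k
KConnected : ∀ {n} → ℕ → Graph n → Set
KConnected {n} k G = k < n × (∀ (S : Subset n) → ∣ S ∣ < k → ConnectedMinus G S)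

IsABPath : ∀ {n} → Graph n → (Fin n → Set) → (Fin n → Set) → List (Fin n) → Set
IsABPath G A B []       = ⊥
IsABPath G A B (x ∷ xs) =
  IsPath G (x ∷ xs) ×
  ((A x × B (endL x xs)) ⊎ (B x × A (endL x xs))) ×
  (∀ w → w LM.∈ (x ∷ xs) → (A w ⊎ B w) → (w ≡ x ⊎ w ≡ endL x xs))

Disjoint : ∀ {n} → List (Fin n) → List (Fin n) → Set
Disjoint {n} p q = ∀ (w : Fin n) → w LM.∈ p → w LM.∈ q → ⊥

MeetExactlyAt : ∀ {n} → List (Fin n) → List (Fin n) → Fin n → Set
MeetExactlyAt {n} p q x = x LM.∈ p × x LM.∈ q × (∀ (w : Fin n) → w LM.∈ p → w LM.∈ q → w ≡ x)

InSet : ∀ {n} → Subset n → Fin n → Set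
InSet X w = w ∈ X

Pair : ∀ {n} → Fin n → Fin n → Fin n → Set
Pair u v w = w ≡ u ⊎ w ≡ v

-- Add to H a twin u' of u, adjacent exactly to the neighbours of u. In the twin graph no set
-- S of fewer than three vertices separates X from {u', u, v}: if u' ∈ S, then S misses u or v,
-- which H - S still connects to X; if u' ∉ S, a path in H - (S - u) from X to u has its last
-- edge redirected to u'. By Menger's theorem there are three disjoint X-{u', u, v} paths, and
-- identifying u' with u turns them into α, β, γ with α ∩ β = {u}.
--
-- Menger's theorem is proved by induction on the edges. Let Y, |Y| < k, separate A from B in
-- G - xy but not in G. An A-B walk avoiding Y then uses xy; let c and d be the first and the
-- last end of xy on it. A separator of A from Y ∪ {c}, or of Y ∪ {d} from B, in G - xy also
-- separates A from B in G. Otherwise there are k disjoint walks from A to Y ∪ {c} and from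
-- Y ∪ {d} to B; every vertex of Y ∪ {c} ends one of the former, so they fit together along Y
-- and the edge cd.

module Submission where

open import Defs
open import Data.Nat using (ℕ; zero; suc; _≤_; _<_; z≤n; s≤s)
import Data.Nat.Properties as ℕ
open import Data.Vec as V using () renaming ([] to []ᵛ; _∷_ to _∷ᵛ_)
open import Data.Fin using (Fin; zero; suc)
open import Data.Fin.Properties using (any?; suc-injective; 0≢1+n) renaming (_≟_ to _≟ᶠ_)
open import Data.Fin.Subset using (Subset; _∈_; _∉_; ∣_∣; _∪_; _∩_; _-_; ⁅_⁆; ⊤; inside; outside) renaming (_⊆_ to _⊆ˢ_)
open import Data.Fin.Subset.Properties using (_∈?_; ∣⁅x⁆∣≡1; drop-there; p⊆q⇒∣p∣≤∣q∣; ∣p─q∣≤∣p∣; p─q⊆p; x∈p∩q⁺; x∈p∩q⁻; x∈p∪q⁺; x∈p∪q⁻; x∈⁅x⁆; x∈⁅y⁆⇒x≡y; ∈⊤; ∣⊤∣≡n; x∈p∧x≢y⇒x∈p-y; x∈p⇒∣p-x∣<∣p∣; ∪-identityʳ)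
open import Data.List using (List; []; _∷_; _++_; map; length; filter; cartesianProduct; allFin)
open import Data.List.Properties using (length-map)
open import Data.List.Relation.Unary.All as All using (All; []; _∷_)
open import Data.List.Relation.Unary.All.Properties using (¬Any⇒All¬) renaming (map⁺ to All-map⁺; ++⁺ to All-++⁺)
open import Data.List.Relation.Unary.Any as Any using (Any; here; there)
open import Data.List.Relation.Unary.Unique.Propositional using (Unique)
open import Data.List.Relation.Unary.Unique.Propositional.Properties using () renaming (map⁺ to Unique-map⁺)
import Data.List.Relation.Unary.AllPairs as AllPairs
open AllPairs using (AllPairs; []; _∷_)
open import Data.List.Relation.Unary.Linked using (Linked; [-]; _∷_)
open import Data.List.Relation.Unary.AllPairs.Properties using () renaming (map⁺ to AllPairs-map⁺)
open import Data.List.Relation.Binary.Pointwise using (Pointwise; []; _∷_; Pointwise-length)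
import Data.List.Relation.Binary.Sublist.Propositional as Sublist
open Sublist using (_⊆_; []; _∷_; _∷ʳ_; ⊆-refl; ⊆-trans; minimum)
import Data.List.Relation.Binary.Sublist.Propositional.Properties as SublistP
open SublistP using (All-resp-⊆)
open import Data.List.Membership.Propositional using (find; lose) renaming (_∈_ to _∈ˡ_; _∉_ to _∉ˡ_)
open import Data.List.Membership.Propositional.Properties using (∈-map⁻; ∈-map⁺; ∈-++⁻; ∈-filter⁺; ∈-filter⁻; ∈-cartesianProduct⁺; ∈-allFin)
import Data.List.Membership.DecPropositional as DecMembership
open import Data.Product using (Σ; _×_; _,_; proj₁; proj₂)
open import Data.Sum using (_⊎_; inj₁; inj₂; map₂) renaming (map to map-⊎)
open import Data.Empty using (⊥; ⊥-elim)
open import Function using (_∘_; id)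
open import Level using (0ℓ)
open import Data.Bool using (true)
open import Data.Bool.Properties using () renaming (_≟_ to _≟ᵇ_)
open import Relation.Nullary using (¬_; ¬?; Dec; yes; no; _×-dec_; _⊎-dec_)
open import Relation.Unary using (Decidable; ∁)
open import Relation.Binary using (Rel; _⇒_; Symmetric)
open import Relation.Binary.PropositionalEquality using (_≡_; refl; sym; trans; cong; subst; subst₂; _≢_)

module _ {A B : Set} {_~_ : B → A → Set} where

  pointwise-choice : {P : A → Set} {P' : B → Set} → (∀ x → P x → Σ B λ y → P' y × y ~ x) →
                     ∀ {xs} → All P xs → Σ (List B) λ ys → All P' ys × Pointwise _~_ ys xs
  pointwise-choice f {[]}     []         = [] , [] , []
  pointwise-choice f {x ∷ xs} (px ∷ pxs) with f x px | pointwise-choice f pxs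
  ... | y , p'y , y~x | ys , p'ys , ys~xs = y ∷ ys , p'y ∷ p'ys , y~x ∷ ys~xs

  module _ {D : A → A → Set} {D' : B → B → Set} (transfer : ∀ {x x' y y'} → y ~ x → y' ~ x' → D x x' → D' y y') where

    All-pointwise : ∀ {x y xs ys} → y ~ x → Pointwise _~_ ys xs → All (D x) xs → All (D' y) ys
    All-pointwise y~x []            []       = []
    All-pointwise y~x (y'~x' ∷ ys~xs) (d ∷ ds) = transfer y~x y'~x' d ∷ All-pointwise y~x ys~xs ds

    AllPairs-pointwise : ∀ {ys xs} → Pointwise _~_ ys xs → AllPairs D xs → AllPairs D' ys
    AllPairs-pointwise []            []         = []
    AllPairs-pointwise (y~x ∷ ys~xs) (dx ∷ dxs) = All-pointwise y~x ys~xs dx ∷ AllPairs-pointwise ys~xs dxs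

module _ {A : Set} where

  AllPairs-lookup : ∀ {D : A → A → Set} → (∀ {x y} → D x y → D y x) → ∀ {xs x y} → AllPairs D xs → x ∈ˡ xs → y ∈ˡ xs → x ≢ y → D x y
  AllPairs-lookup sym (_ ∷ _)    (here refl) (here refl) x≢x = ⊥-elim (x≢x refl)
  AllPairs-lookup sym (dx ∷ _)   (here refl) (there y∈)  _   = All.lookup dx y∈
  AllPairs-lookup sym (dy ∷ _)   (there x∈)  (here refl) _   = sym (All.lookup dy x∈)
  AllPairs-lookup sym (_ ∷ dxs)  (there x∈)  (there y∈)  x≢y = AllPairs-lookup sym dxs x∈ y∈ x≢y

  Unique-map⁺-on : ∀ {B : Set} (f : A → B) {xs} → (∀ {x y} → x ∈ˡ xs → y ∈ˡ xs → f x ≡ f y → x ≡ y) → Unique xs → Unique (map f xs)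
  Unique-map⁺-on f {[]}     inj []       = []
  Unique-map⁺-on f {x ∷ xs} inj (x∉ ∷ u) =
    All-map⁺ (All.tabulate λ y∈ fx≡fy → All.lookup x∉ y∈ (inj (here refl) (there y∈) fx≡fy))
    ∷ Unique-map⁺-on f (λ x∈ y∈ → inj (there x∈) (there y∈)) u

  Unique-resp-⊇ : ∀ {xs ys : List A} → xs ⊆ ys → Unique ys → Unique xs
  Unique-resp-⊇ []          []      = []
  Unique-resp-⊇ (_ ∷ʳ s)    (_ ∷ u) = Unique-resp-⊇ s u
  Unique-resp-⊇ (refl ∷ s)  (a ∷ u) = All-resp-⊆ s a ∷ Unique-resp-⊇ s u

module _ {n : ℕ} where
  open DecMembership (_≟ᶠ_ {n}) using () renaming (_∈?_ to _∈ˡ?_)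

  length≤∣∣ : (xs : List (Fin n)) (S : Subset n) → Unique xs → All (_∈ S) xs → length xs ≤ ∣ S ∣
  length≤∣∣ []       S []        []         = z≤n
  length≤∣∣ (x ∷ xs) S (x∉ ∷ u) (x∈S ∷ xs⊆S) = ℕ.≤-trans (s≤s (length≤∣∣ xs (S - x) u xs⊆S-x)) (x∈p⇒∣p-x∣<∣p∣ x∈S)
    where
      xs⊆S-x : All (_∈ S - x) xs
      xs⊆S-x = All.zipWith (λ (x≢y , y∈S) → x∈p∧x≢y⇒x∈p-y y∈S (λ y≡x → x≢y (sym y≡x))) (x∉ , xs⊆S)

  length≤n : (xs : List (Fin n)) → Unique xs → length xs ≤ n
  length≤n xs u = subst (length xs ≤_) (∣⊤∣≡n n) (length≤∣∣ xs ⊤ u (All.universal (λ _ → ∈⊤) xs))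

  long-unique-covers : (xs : List (Fin n)) (S : Subset n) → Unique xs → All (_∈ S) xs → ∣ S ∣ ≤ length xs →
                       ∀ {s} → s ∈ S → s ∈ˡ xs
  long-unique-covers xs S u xs⊆S ∣S∣≤ {s} s∈S with s ∈ˡ? xs
  ... | yes s∈xs = s∈xs
  ... | no  s∉xs = ⊥-elim (ℕ.<-irrefl refl (ℕ.≤-trans (ℕ.≤-trans (s≤s (length≤∣∣ xs (S - s) u xs⊆S-s)) (x∈p⇒∣p-x∣<∣p∣ s∈S)) ∣S∣≤))
    where
      xs⊆S-s : All (_∈ S - s) xs
      xs⊆S-s = All.tabulate λ {y} y∈xs → x∈p∧x≢y⇒x∈p-y (All.lookup xs⊆S y∈xs) λ { refl → s∉xs y∈xs }

∣p∪⁅x⁆∣≤1+∣p∣ : ∀ {n} (p : Subset n) (x : Fin n) → ∣ p ∪ ⁅ x ⁆ ∣ ≤ suc ∣ p ∣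
∣p∪⁅x⁆∣≤1+∣p∣ (inside  ∷ᵛ p) zero    = s≤s (ℕ.m≤n⇒m≤1+n (ℕ.≤-reflexive (cong ∣_∣ (∪-identityʳ p))))
∣p∪⁅x⁆∣≤1+∣p∣ (outside ∷ᵛ p) zero    = s≤s (ℕ.≤-reflexive (cong ∣_∣ (∪-identityʳ p)))
∣p∪⁅x⁆∣≤1+∣p∣ (inside  ∷ᵛ p) (suc x) = s≤s (∣p∪⁅x⁆∣≤1+∣p∣ p x)
∣p∪⁅x⁆∣≤1+∣p∣ (outside ∷ᵛ p) (suc x) = ∣p∪⁅x⁆∣≤1+∣p∣ p x

∃-∈-∉ : ∀ {n} (p q : Subset n) → ∣ q ∣ < ∣ p ∣ → Σ (Fin n) λ x → x ∈ p × x ∉ q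
∃-∈-∉ p q ∣q∣<∣p∣ with any? (λ x → (x ∈? p) ×-dec (¬? (x ∈? q)))
... | yes found = found
... | no ¬found = ⊥-elim (ℕ.<⇒≱ ∣q∣<∣p∣ (p⊆q⇒∣p∣≤∣q∣ p⊆q))
  where
    p⊆q : p ⊆ˢ q
    p⊆q {x} x∈p with x ∈? q
    ... | yes x∈q = x∈q
    ... | no  x∉q = ⊥-elim (¬found (x , x∈p , x∉q))

2≤∣p∣ : ∀ {n} {p : Subset n} {x y} → x ∈ p → y ∈ p → x ≢ y → 2 ≤ ∣ p ∣
2≤∣p∣ x∈p y∈p x≢y = ℕ.≤-trans (s≤s (ℕ.≤-trans (s≤s z≤n) (x∈p⇒∣p-x∣<∣p∣ (x∈p∧x≢y⇒x∈p-y y∈p (x≢y ∘ sym))))) (x∈p⇒∣p-x∣<∣p∣ x∈p)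

enumerate : ∀ {n} (S : Subset n) → Σ (List (Fin n)) λ xs → Unique xs × All (_∈ S) xs × ∣ S ∣ ≤ length xs
enumerate []ᵛ = [] , [] , [] , z≤n
enumerate (b ∷ᵛ S) with enumerate S
... | xs , u , xs⊆S , ∣S∣≤ with b
...   | inside  = zero ∷ map suc xs , All-map⁺ (All.universal (λ _ ()) xs) ∷ Unique-map⁺ suc-injective u ,
                  V.here ∷ All-map⁺ (All.map V.there xs⊆S) , s≤s (subst (_ ≤_) (sym (length-map suc xs)) ∣S∣≤)
...   | outside = map suc xs , Unique-map⁺ suc-injective u ,
                  All-map⁺ (All.map V.there xs⊆S) , subst (_ ≤_) (sym (length-map suc xs)) ∣S∣≤

-- Walks

data Walk {n} (R : Rel (Fin n) 0ℓ) : Fin n → Fin n → Set where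
  [_]    : ∀ a → Walk R a a
  _∷⟨_⟩_ : ∀ a {b c} → R a b → Walk R b c → Walk R a c

module _ {n : ℕ} {R : Rel (Fin n) 0ℓ} where
  open DecMembership (_≟ᶠ_ {n}) using () renaming (_∈?_ to _∈ˡ?_)

  vertices initVertices tailVertices : ∀ {a b} → Walk R a b → List (Fin n)
  vertices [ a ]          = a ∷ []
  vertices (a ∷⟨ _ ⟩ w)   = a ∷ vertices w
  initVertices [ a ]        = []
  initVertices (a ∷⟨ _ ⟩ w) = a ∷ initVertices w
  tailVertices [ a ]        = []
  tailVertices (a ∷⟨ _ ⟩ w) = vertices w

  lengthᵂ : ∀ {a b} → Walk R a b → ℕ
  lengthᵂ [ a ]        = 0
  lengthᵂ (a ∷⟨ _ ⟩ w) = suc (lengthᵂ w)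

  length-vertices : ∀ {a b} (w : Walk R a b) → length (vertices w) ≡ suc (lengthᵂ w)
  length-vertices [ a ]        = refl
  length-vertices (a ∷⟨ _ ⟩ w) = cong suc (length-vertices w)

  vertices≡source∷tail : ∀ {a b} (w : Walk R a b) → vertices w ≡ a ∷ tailVertices w
  vertices≡source∷tail [ a ]        = refl
  vertices≡source∷tail (a ∷⟨ _ ⟩ w) = refl

  initVertices⊆ : ∀ {a b} (w : Walk R a b) → initVertices w ⊆ vertices w
  initVertices⊆ [ a ]        = a ∷ʳ []
  initVertices⊆ (a ∷⟨ _ ⟩ w) = refl ∷ initVertices⊆ w

  tailVertices⊆ : ∀ {a b} (w : Walk R a b) → tailVertices w ⊆ vertices w
  tailVertices⊆ [ a ]        = a ∷ʳ []
  tailVertices⊆ (a ∷⟨ _ ⟩ w) = a ∷ʳ ⊆-refl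

  source∈ : ∀ {a b} (w : Walk R a b) → a ∈ˡ vertices w
  source∈ [ a ]        = here refl
  source∈ (a ∷⟨ _ ⟩ w) = here refl

  target∈ : ∀ {a b} (w : Walk R a b) → b ∈ˡ vertices w
  target∈ [ a ]        = here refl
  target∈ (a ∷⟨ _ ⟩ w) = there (target∈ w)

  ∈-vertices⇒target⊎init : ∀ {a b z} (w : Walk R a b) → z ∈ˡ vertices w → z ≡ b ⊎ z ∈ˡ initVertices w
  ∈-vertices⇒target⊎init [ a ]        (here e)  = inj₁ e
  ∈-vertices⇒target⊎init (a ∷⟨ _ ⟩ w) (here e)  = inj₂ (here e)
  ∈-vertices⇒target⊎init (a ∷⟨ _ ⟩ w) (there m) = map₂ there (∈-vertices⇒target⊎init w m)

  ∈-vertices⇒source⊎tail : ∀ {a b z} (w : Walk R a b) → z ∈ˡ vertices w → z ≡ a ⊎ z ∈ˡ tailVertices w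
  ∈-vertices⇒source⊎tail [ a ]        (here e)  = inj₁ e
  ∈-vertices⇒source⊎tail (a ∷⟨ _ ⟩ w) (here e)  = inj₁ e
  ∈-vertices⇒source⊎tail (a ∷⟨ _ ⟩ w) (there m) = inj₂ m

  Linked-vertices : ∀ {a b} (w : Walk R a b) → Linked R (vertices w)
  Linked-vertices [ a ]                    = [-]
  Linked-vertices (a ∷⟨ r ⟩ [ b ])         = r ∷ [-]
  Linked-vertices (a ∷⟨ r ⟩ w@(_ ∷⟨ _ ⟩ _)) = r ∷ Linked-vertices w

  endL-tailVertices : ∀ {a b} (w : Walk R a b) → endL a (tailVertices w) ≡ b
  endL-tailVertices [ a ]                    = refl
  endL-tailVertices (a ∷⟨ r ⟩ [ b ])         = refl
  endL-tailVertices (a ∷⟨ r ⟩ w@(_ ∷⟨ _ ⟩ _)) = endL-tailVertices w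

  _++ᵂ_ : ∀ {a b c} → Walk R a b → Walk R b c → Walk R a c
  [ a ]        ++ᵂ q = q
  (a ∷⟨ r ⟩ p) ++ᵂ q = a ∷⟨ r ⟩ (p ++ᵂ q)

  vertices-++ᵂ : ∀ {a b c} (p : Walk R a b) (q : Walk R b c) → vertices (p ++ᵂ q) ≡ initVertices p ++ vertices q
  vertices-++ᵂ [ a ]        q = refl
  vertices-++ᵂ (a ∷⟨ _ ⟩ p) q = cong (a ∷_) (vertices-++ᵂ p q)

  join : ∀ {a b b' c} → Walk R a b → b ≡ b' → Walk R b' c → Walk R a c
  join p refl q = p ++ᵂ q

  vertices-join : ∀ {a b b' c} (p : Walk R a b) (e : b ≡ b') (q : Walk R b' c) → vertices (join p e q) ≡ initVertices p ++ vertices q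
  vertices-join p refl q = vertices-++ᵂ p q

  ∈-join⁻ : ∀ {a b b' c z} (p : Walk R a b) (e : b ≡ b') (q : Walk R b' c) → z ∈ˡ vertices (join p e q) → z ∈ˡ initVertices p ⊎ z ∈ˡ vertices q
  ∈-join⁻ p e q m = ∈-++⁻ (initVertices p) (subst (_ ∈ˡ_) (vertices-join p e q) m)

  All-join : ∀ {P : Fin n → Set} {a b b' c} (p : Walk R a b) (e : b ≡ b') (q : Walk R b' c) →
             All P (initVertices p) → All P (vertices q) → All P (vertices (join p e q))
  All-join p e q Pp Pq = subst (All _) (sym (vertices-join p e q)) (All-++⁺ Pp Pq)

  prefixTo : ∀ {a b z} (w : Walk R a b) → z ∈ˡ vertices w → Σ (Walk R a z) λ p → initVertices p ⊆ initVertices w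
  prefixTo [ a ]        (here refl) = [ a ] , []
  prefixTo (a ∷⟨ _ ⟩ w) (here refl) = [ a ] , minimum _
  prefixTo (a ∷⟨ r ⟩ w) (there m) with prefixTo w m
  ... | p , s = a ∷⟨ r ⟩ p , refl ∷ s

  suffixFrom : ∀ {a b z} (w : Walk R a b) → z ∈ˡ vertices w →
               Σ (Walk R z b) λ q → vertices q ⊆ vertices w × tailVertices q ⊆ tailVertices w
  suffixFrom w@([ _ ])      (here refl) = w , ⊆-refl , ⊆-refl
  suffixFrom w@(_ ∷⟨ _ ⟩ _) (here refl) = w , ⊆-refl , ⊆-refl
  suffixFrom (a ∷⟨ _ ⟩ w) (there m) with suffixFrom w m
  ... | q , s , t = q , a ∷ʳ s , ⊆-trans t (tailVertices⊆ w)

  splice : ∀ {a z s b v} (p : Walk R a z) (q : Walk R s b) → v ∈ˡ vertices p → v ∈ˡ vertices q →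
           Σ (Walk R a b) λ w → vertices w ⊆ initVertices p ++ v ∷ tailVertices q
  splice p q v∈p v∈q with prefixTo p v∈p | suffixFrom q v∈q
  ... | p' , ip'⊆ip | q' , _ , tq'⊆tq =
    p' ++ᵂ q' , subst (_⊆ _) (sym (trans (vertices-++ᵂ p' q') (cong (_ ++_) (vertices≡source∷tail q'))))
                      (SublistP.++⁺ ip'⊆ip (refl ∷ tq'⊆tq))

  firstHit : ∀ {P : Fin n → Set} → Decidable P → ∀ {a b} (w : Walk R a b) → Any P (vertices w) →
    Σ (Fin n) λ z → P z × Σ (Walk R a z) λ p → All (∁ P) (initVertices p) × vertices p ⊆ vertices w
  firstHit P? [ a ] (here pa) = a , pa , [ a ] , [] , ⊆-refl
  firstHit P? (a ∷⟨ r ⟩ w) any with P? a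
  ... | yes pa = a , pa , [ a ] , [] , refl ∷ minimum _
  firstHit P? (a ∷⟨ r ⟩ w) (here pa)  | no ¬pa = ⊥-elim (¬pa pa)
  firstHit P? (a ∷⟨ r ⟩ w) (there any) | no ¬pa with firstHit P? w any
  ... | z , pz , p , avoid , s = z , pz , a ∷⟨ r ⟩ p , ¬pa ∷ avoid , refl ∷ s

  lastHit : ∀ {P : Fin n → Set} → Decidable P → ∀ {a b} (w : Walk R a b) → Any P (vertices w) →
    Σ (Fin n) λ z → P z × Σ (Walk R z b) λ q → All (∁ P) (tailVertices q) × vertices q ⊆ vertices w
  lastHit P? [ a ] (here pa) = a , pa , [ a ] , [] , ⊆-refl
  lastHit P? (a ∷⟨ r ⟩ w) any with Any.any? P? (vertices w)
  ... | yes anyw with lastHit P? w anyw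
  ...   | z , pz , q , avoid , s = z , pz , q , avoid , a ∷ʳ s
  lastHit P? (a ∷⟨ r ⟩ w) (here pa)  | no ¬anyw = a , pa , a ∷⟨ r ⟩ w , ¬Any⇒All¬ _ ¬anyw , ⊆-refl
  lastHit P? (a ∷⟨ r ⟩ w) (there any) | no ¬anyw = ⊥-elim (¬anyw any)

  shortcut : ∀ {a b} (w : Walk R a b) → Σ (Walk R a b) λ p → Unique (vertices p) × vertices p ⊆ vertices w
  shortcut [ a ] = [ a ] , [] ∷ [] , ⊆-refl
  shortcut (a ∷⟨ r ⟩ w) with shortcut w
  ... | p , u , s with a ∈ˡ? vertices p
  ...   | yes m with suffixFrom p m
  ...     | q , s' , _ = q , Unique-resp-⊇ s' u , a ∷ʳ ⊆-trans s' s
  shortcut (a ∷⟨ r ⟩ w) | p , u , s | no ¬m =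
    a ∷⟨ r ⟩ p , ¬Any⇒All¬ _ ¬m ∷ u , refl ∷ s

module _ {n m : ℕ} {R : Rel (Fin n) 0ℓ} {R' : Rel (Fin m) 0ℓ} (f : Fin n → Fin m) (f-hom : ∀ {i j} → R i j → R' (f i) (f j)) where

  mapᵂ : ∀ {a b} → Walk R a b → Walk R' (f a) (f b)
  mapᵂ [ a ]        = [ f a ]
  mapᵂ (a ∷⟨ r ⟩ w) = f a ∷⟨ f-hom r ⟩ mapᵂ w

  vertices-mapᵂ : ∀ {a b} (w : Walk R a b) → vertices (mapᵂ w) ≡ map f (vertices w)
  vertices-mapᵂ [ a ]        = refl
  vertices-mapᵂ (a ∷⟨ _ ⟩ w) = cong (f a ∷_) (vertices-mapᵂ w)

module _ {n : ℕ} {R R' : Rel (Fin n) 0ℓ} (R⇒R' : R ⇒ R') where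

  weaken : ∀ {a b} → Walk R a b → Walk R' a b
  weaken [ a ]        = [ a ]
  weaken (a ∷⟨ r ⟩ w) = a ∷⟨ R⇒R' r ⟩ weaken w

  vertices-weaken : ∀ {a b} (w : Walk R a b) → vertices (weaken w) ≡ vertices w
  vertices-weaken [ a ]        = refl
  vertices-weaken (a ∷⟨ _ ⟩ w) = cong (a ∷_) (vertices-weaken w)

-- Menger's theorem

module _ {n : ℕ} where

  Avoids : Subset n → List (Fin n) → Set
  Avoids S = All (_∉ S)

  Separates : Rel (Fin n) 0ℓ → (A B S : Subset n) → Set
  Separates R A B S = ∀ {a b} → a ∈ A → b ∈ B → (w : Walk R a b) → ¬ Avoids S (vertices w)

  ReachesAvoiding : Rel (Fin n) 0ℓ → (S B : Subset n) → Fin n → Set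
  ReachesAvoiding R S B a = Σ (Fin n) λ b → b ∈ B × Σ (Walk R a b) λ w → Avoids S (vertices w)

  module _ {R : Rel (Fin n) 0ℓ} (R? : ∀ i j → Dec (R i j)) (S B : Subset n) where

    ReachesWithin : ℕ → Fin n → Set
    ReachesWithin m a = Σ (Fin n) λ b → b ∈ B × Σ (Walk R a b) λ w → Avoids S (vertices w) × lengthᵂ w ≤ m

    reachesWithin? : ∀ m a → Dec (ReachesWithin m a)
    reachesWithin? m a with a ∈? S | a ∈? B
    ... | yes a∈S | _ = no λ (_ , _ , w , avoid , _) → All.lookup avoid (source∈ w) a∈S
    ... | no a∉S | yes a∈B = yes (a , a∈B , [ a ] , a∉S ∷ [] , z≤n)
    reachesWithin? zero a | no _ | no a∉B = no λ { (_ , b∈B , [ _ ] , _) → a∉B b∈B }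
    reachesWithin? (suc m) a | no a∉S | no a∉B with any? (λ j → R? a j ×-dec reachesWithin? m j)
    ... | yes (j , r , b , b∈B , w , avoid , len≤) = yes (b , b∈B , a ∷⟨ r ⟩ w , a∉S ∷ avoid , s≤s len≤)
    ... | no ¬step = no λ { (_ , b∈B , [ _ ] , _) → a∉B b∈B
                          ; (b , b∈B , _∷⟨_⟩_ _ {j} r w , _ ∷ avoid , s≤s len≤) → ¬step (j , r , b , b∈B , w , avoid , len≤) }

    -- A shortest witness is a path, so walks of length below n suffice.
    reachesAvoiding? : ∀ a → Dec (ReachesAvoiding R S B a)
    reachesAvoiding? a with reachesWithin? n a
    ... | yes (b , b∈B , w , avoid , _) = yes (b , b∈B , w , avoid)
    ... | no ¬within = no λ (b , b∈B , w , avoid) → ¬within (withinBound b∈B w avoid)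
      where
        withinBound : ∀ {b} → b ∈ B → (w : Walk R a b) → Avoids S (vertices w) → ReachesWithin n a
        withinBound b∈B w avoid with shortcut w
        ... | p , u , p⊆w = _ , b∈B , p , All-resp-⊆ p⊆w avoid ,
              ℕ.≤-pred (subst (_≤ suc n) (length-vertices p) (ℕ.m≤n⇒m≤1+n (length≤n (vertices p) u)))

record Route {n : ℕ} (R : Rel (Fin n) 0ℓ) : Set where
  constructor route
  field
    {source target} : Fin n
    walk            : Walk R source target

  routeVertices : List (Fin n)
  routeVertices = vertices walk

open Route public

module _ {n : ℕ} where

  DisjointRoutes : {R : Rel (Fin n) 0ℓ} → Route R → Route R → Set
  DisjointRoutes p q = Disjoint (routeVertices p) (routeVertices q)

  DisjointRoutes-sym : {R : Rel (Fin n) 0ℓ} {p q : Route R} → DisjointRoutes p q → DisjointRoutes q p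
  DisjointRoutes-sym disjoint v v∈q v∈p = disjoint v v∈p v∈q

  DisjointRoutes⇒source≢ : {R : Rel (Fin n) 0ℓ} {p q : Route R} → DisjointRoutes p q → source p ≢ source q
  DisjointRoutes⇒source≢ {p = route p} {route q} disjoint s≡s' =
    disjoint _ (source∈ p) (subst (_∈ˡ vertices q) (sym s≡s') (source∈ q))

  DisjointRoutes⇒target≢ : {R : Rel (Fin n) 0ℓ} {p q : Route R} → DisjointRoutes p q → target p ≢ target q
  DisjointRoutes⇒target≢ {p = route p} {route q} disjoint t≡t' =
    disjoint _ (target∈ p) (subst (_∈ˡ vertices q) (sym t≡t') (target∈ q))

  record Linkage (R : Rel (Fin n) 0ℓ) (A B : Subset n) (k : ℕ) : Set where
    constructor linkage
    field
      routes   : List (Route R)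
      A-to-B   : All (λ p → source p ∈ A × target p ∈ B) routes
      disjoint : AllPairs DisjointRoutes routes
      size     : k ≤ length routes

  record SmallSeparator (R : Rel (Fin n) 0ℓ) (A B : Subset n) (k : ℕ) : Set where
    constructor separator
    field
      set       : Subset n
      separates : Separates R A B set
      small     : ∣ set ∣ < k

  Menger : Rel (Fin n) 0ℓ → (A B : Subset n) → ℕ → Set
  Menger R A B k = SmallSeparator R A B k ⊎ Linkage R A B k

  module _ {R R' : Rel (Fin n) 0ℓ} where

    _≼_ : Route R' → Route R → Set
    p' ≼ p = routeVertices p' ⊆ routeVertices p

    DisjointRoutes-resp-≼ : ∀ {p q p' q'} → p' ≼ p → q' ≼ q → DisjointRoutes p q → DisjointRoutes p' q'
    DisjointRoutes-resp-≼ p'≼p q'≼q disjoint w w∈p' w∈q' = disjoint w (Sublist.lookup p'≼p w∈p') (Sublist.lookup q'≼q w∈q')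

    refine : {Q : Route R → Set} {Q' : Route R' → Set} → ((p : Route R) → Q p → Σ (Route R') λ p' → Q' p' × p' ≼ p) →
             ∀ {ps} → All Q ps → AllPairs DisjointRoutes ps →
             Σ (List (Route R')) λ ps' → All Q' ps' × AllPairs DisjointRoutes ps' × length ps' ≡ length ps
    refine f qs disjoint with pointwise-choice f qs
    ... | ps' , q's , ps'≼ps = ps' , q's , AllPairs-pointwise DisjointRoutes-resp-≼ ps'≼ps disjoint , Pointwise-length ps'≼ps

    Linkage-refine : ∀ {A B A' B' k} → ((p : Route R) → source p ∈ A × target p ∈ B → Σ (Route R') λ p' → (source p' ∈ A' × target p' ∈ B') × p' ≼ p) →
                     Linkage R A B k → Linkage R' A' B' k
    Linkage-refine f (linkage ps A-to-B disjoint size) with refine f A-to-B disjoint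
    ... | ps' , A-to-B' , disjoint' , len = linkage ps' A-to-B' disjoint' (subst (_ ≤_) (sym len) size)

    Linkage-weaken : R ⇒ R' → ∀ {A B k} → Linkage R A B k → Linkage R' A B k
    Linkage-weaken R⇒R' = Linkage-refine λ (route w) ends → route (weaken R⇒R' w) , ends , Sublist.⊆-reflexive (vertices-weaken R⇒R' w)

    Separates-weaken : R ⇒ R' → ∀ {A B S} → Separates R' A B S → Separates R A B S
    Separates-weaken R⇒R' sep a∈A b∈B w avoid =
      sep a∈A b∈B (weaken R⇒R' w) (subst (Avoids _) (sym (vertices-weaken R⇒R' w)) avoid)

module _ {n : ℕ} where

  Joins : Fin n × Fin n → Rel (Fin n) 0ℓ
  Joins (x , y) i j = (i ≡ x × j ≡ y) ⊎ (i ≡ y × j ≡ x)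

  Edges : List (Fin n × Fin n) → Rel (Fin n) 0ℓ
  Edges L i j = Any (λ e → Joins e i j) L

  edges? : ∀ L i j → Dec (Edges L i j)
  edges? L i j = Any.any? (λ (x , y) → ((i ≟ᶠ x) ×-dec (j ≟ᶠ y)) ⊎-dec ((i ≟ᶠ y) ×-dec (j ≟ᶠ x))) L

  menger-edgeless : ∀ A B k → Menger (Edges []) A B k
  menger-edgeless A B k with k ℕ.≤? ∣ A ∩ B ∣
  ... | no k≰ = inj₁ (separator (A ∩ B) separates (ℕ.≰⇒> k≰))
    where
      separates : Separates (Edges []) A B (A ∩ B)
      separates a∈A b∈B [ a ] (a∉A∩B ∷ []) = a∉A∩B (x∈p∩q⁺ (a∈A , b∈B))
  ... | yes k≤ with enumerate (A ∩ B)
  ...   | xs , u , xs⊆A∩B , ∣A∩B∣≤ =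
    inj₂ (linkage (map (λ a → route [ a ]) xs) (All-map⁺ (All.map (x∈p∩q⁻ A B) xs⊆A∩B))
            (AllPairs-map⁺ (AllPairs.map (λ { a≢b c (here c≡a) (here c≡b) → a≢b (trans (sym c≡a) c≡b) }) u))
            (ℕ.≤-trans k≤ (ℕ.≤-trans ∣A∩B∣≤ (ℕ.≤-reflexive (sym (length-map _ xs))))))

module MengerStep {n : ℕ} (x y : Fin n) (L : List (Fin n × Fin n))
                  (menger-L : ∀ A B k → Menger (Edges L) A B k) where

  G G⁻ : Rel (Fin n) 0ℓ
  G  = Edges ((x , y) ∷ L)
  G⁻ = Edges L

  Endpoint : Fin n → Set
  Endpoint z = z ≡ x ⊎ z ≡ y

  endpoint? : Decidable Endpoint
  endpoint? z = (z ≟ᶠ x) ⊎-dec (z ≟ᶠ y)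

  G⇒G⁻⊎xy : ∀ {i j} → G i j → G⁻ i j ⊎ (Endpoint i × Endpoint j)
  G⇒G⁻⊎xy (here (inj₁ (i≡x , j≡y))) = inj₂ (inj₁ i≡x , inj₂ j≡y)
  G⇒G⁻⊎xy (here (inj₂ (i≡y , j≡x))) = inj₂ (inj₂ i≡y , inj₁ j≡x)
  G⇒G⁻⊎xy (there r)                 = inj₁ r

  dropEdgeᴵ : ∀ {a b} (w : Walk G a b) → All (∁ Endpoint) (initVertices w) →
              Σ (Walk G⁻ a b) λ w' → vertices w' ≡ vertices w × initVertices w' ≡ initVertices w
  dropEdgeᴵ [ a ]        _ = [ a ] , refl , refl
  dropEdgeᴵ (a ∷⟨ r ⟩ w) (a-clear ∷ clear) with G⇒G⁻⊎xy r | dropEdgeᴵ w clear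
  ... | inj₁ r' | w' , same , same-init = a ∷⟨ r' ⟩ w' , cong (a ∷_) same , cong (a ∷_) same-init
  ... | inj₂ (a-end , _) | _ = ⊥-elim (a-clear a-end)

  dropEdgeᵀ : ∀ {a b} (w : Walk G a b) → All (∁ Endpoint) (tailVertices w) →
              Σ (Walk G⁻ a b) λ w' → vertices w' ≡ vertices w × tailVertices w' ≡ tailVertices w
  dropEdgeᵀ [ a ]        _ = [ a ] , refl , refl
  dropEdgeᵀ (a ∷⟨ r ⟩ w) clear with G⇒G⁻⊎xy r | dropEdgeᵀ w (All-resp-⊆ (tailVertices⊆ w) clear)
  ... | inj₁ r' | w' , same , _ = a ∷⟨ r' ⟩ w' , cong (a ∷_) same , same
  ... | inj₂ (_ , b-end) | _ = ⊥-elim (All.lookup clear (source∈ w) b-end)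

  edge-free : ∀ {A B Y a b} → Separates G⁻ A B Y → a ∈ A → b ∈ B → (w : Walk G a b) →
              All (∁ Endpoint) (initVertices w) → ¬ Avoids Y (vertices w)
  edge-free sepY a∈A b∈B w clear avoid with dropEdgeᴵ w clear
  ... | w' , same , _ = sepY a∈A b∈B w' (subst (Avoids _) (sym same) avoid)

  module Detour (A B Y : Subset n) (sepY : Separates G⁻ A B Y) {c d : Fin n}
                (c-or-d : ∀ {z} → Endpoint z → z ≡ c ⊎ z ≡ d) where

    Blocked : Fin n → Set
    Blocked z = z ∈ Y ⊎ Endpoint z

    blocked? : Decidable Blocked
    blocked? z = (z ∈? Y) ⊎-dec endpoint? z

    must-hit : ∀ {a b} → a ∈ A → b ∈ B → (w : Walk G a b) → Any Blocked (vertices w)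
    must-hit a∈A b∈B w with Any.any? blocked? (vertices w)
    ... | yes hit  = hit
    ... | no ¬hit = ⊥-elim (edge-free sepY a∈A b∈B w (All-resp-⊆ (initVertices⊆ w) (All.map (_∘ inj₂) clear)) (All.map (_∘ inj₁) clear))
      where
        clear : All (∁ Blocked) (vertices w)
        clear = ¬Any⇒All¬ _ ¬hit

    separates-via-c : ∀ {b₀} (w₂ : Walk G⁻ d b₀) → b₀ ∈ B → Avoids Y (vertices w₂) →
                      ∀ {T} → Separates G⁻ A (Y ∪ ⁅ c ⁆) T → Separates G A B T
    separates-via-c w₂ b₀∈B w₂-avoids {T} sepT a∈A b∈B w w-avoids with firstHit blocked? w (must-hit a∈A b∈B w)
    ... | z , z-blocked , w₁ , clear , w₁⊆w with dropEdgeᴵ w₁ (All.map (_∘ inj₂) clear)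
    ...   | w₁' , same , same-init = first-block z-blocked
      where
        w₁'-avoids : Avoids T (vertices w₁')
        w₁'-avoids = subst (Avoids T) (sym same) (All-resp-⊆ w₁⊆w w-avoids)
        first-block : Blocked z → ⊥
        first-block (inj₁ z∈Y) = sepT a∈A (x∈p∪q⁺ (inj₁ z∈Y)) w₁' w₁'-avoids
        first-block (inj₂ z-end) with c-or-d z-end
        ... | inj₁ refl = sepT a∈A (x∈p∪q⁺ (inj₂ (x∈⁅x⁆ z))) w₁' w₁'-avoids
        ... | inj₂ z≡d  = sepY a∈A b₀∈B (join w₁' z≡d w₂)
                            (All-join w₁' z≡d w₂ (subst (Avoids Y) (sym same-init) (All.map (_∘ inj₁) clear)) w₂-avoids)

    separates-via-d : ∀ {a₀} (w₁ : Walk G⁻ a₀ c) → a₀ ∈ A → Avoids Y (vertices w₁) →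
                      ∀ {T} → Separates G⁻ (Y ∪ ⁅ d ⁆) B T → Separates G A B T
    separates-via-d w₁ a₀∈A w₁-avoids {T} sepT a∈A b∈B w w-avoids with lastHit blocked? w (must-hit a∈A b∈B w)
    ... | z , z-blocked , w₂ , clear , w₂⊆w with dropEdgeᵀ w₂ (All.map (_∘ inj₂) clear)
    ...   | w₂' , same , same-tail = last-block z-blocked
      where
        w₂'-avoids : Avoids T (vertices w₂')
        w₂'-avoids = subst (Avoids T) (sym same) (All-resp-⊆ w₂⊆w w-avoids)
        last-block : Blocked z → ⊥
        last-block (inj₁ z∈Y) = sepT (x∈p∪q⁺ (inj₁ z∈Y)) b∈B w₂' w₂'-avoids
        last-block (inj₂ z-end) with c-or-d z-end
        ... | inj₂ refl = sepT (x∈p∪q⁺ (inj₂ (x∈⁅x⁆ z))) b∈B w₂' w₂'-avoids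
        ... | inj₁ z≡c  = sepY a₀∈A b∈B (join w₁ (sym z≡c) w₂')
                            (All-join w₁ (sym z≡c) w₂' (All-resp-⊆ (initVertices⊆ w₁) w₁-avoids)
                               (subst (Avoids Y) (sym (vertices≡source∷tail w₂'))
                                  (z∉Y ∷ subst (Avoids Y) (sym same-tail) (All.map (_∘ inj₁) clear))))
          where
            z∉Y : z ∉ Y
            z∉Y = subst (_∉ Y) (sym z≡c) (All.lookup w₁-avoids (target∈ w₁))

  other-endpoint : ∀ {c d z} → Endpoint c → Endpoint d → c ≢ d → Endpoint z → z ≡ c ⊎ z ≡ d
  other-endpoint (inj₁ refl) _           _   (inj₁ refl) = inj₁ refl
  other-endpoint (inj₂ refl) _           _   (inj₂ refl) = inj₁ refl
  other-endpoint (inj₁ refl) (inj₂ refl) _   (inj₂ refl) = inj₂ refl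
  other-endpoint (inj₂ refl) (inj₁ refl) _   (inj₁ refl) = inj₂ refl
  other-endpoint (inj₁ refl) (inj₁ refl) c≢c _           = ⊥-elim (c≢c refl)
  other-endpoint (inj₂ refl) (inj₂ refl) c≢c _           = ⊥-elim (c≢c refl)

  endpoints-adjacent : ∀ {c d} → Endpoint c → Endpoint d → c ≢ d → G c d
  endpoints-adjacent (inj₁ c≡x) (inj₂ d≡y) _   = here (inj₁ (c≡x , d≡y))
  endpoints-adjacent (inj₂ c≡y) (inj₁ d≡x) _   = here (inj₂ (c≡y , d≡x))
  endpoints-adjacent (inj₁ refl) (inj₁ refl) c≢c = ⊥-elim (c≢c refl)
  endpoints-adjacent (inj₂ refl) (inj₂ refl) c≢c = ⊥-elim (c≢c refl)

  module Splice (A B Y : Subset n) (sepY : Separates G⁻ A B Y) {c d : Fin n}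
                (c∉Y : c ∉ Y) (d∉Y : d ∉ Y) (c≢d : c ≢ d) (cd : G c d) where

    Yc Yd : Subset n
    Yc = Y ∪ ⁅ c ⁆
    Yd = Y ∪ ⁅ d ⁆

    ∈Y∪⁅⁆ : ∀ {v e} → v ∈ Y ∪ ⁅ e ⁆ → v ∈ Y ⊎ v ≡ e
    ∈Y∪⁅⁆ {e = e} v∈ = map₂ (x∈⁅y⁆⇒x≡y e) (x∈p∪q⁻ Y ⁅ e ⁆ v∈)

    Avoids-∪ : ∀ {e xs} → Avoids (Y ∪ ⁅ e ⁆) xs → Avoids Y xs
    Avoids-∪ = All.map λ v∉ v∈Y → v∉ (x∈p∪q⁺ (inj₁ v∈Y))

    EntersYc LeavesYd : Route G⁻ → Set
    EntersYc p = source p ∈ A × target p ∈ Yc × Avoids Yc (initVertices (walk p))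
    LeavesYd q = source q ∈ Yd × target q ∈ B × Avoids Yd (tailVertices (walk q))

    -- A walk into Yc ending at z continues with a walk out of Yd starting at s: through the
    -- edge cd, or directly at a vertex of Y.
    Meets : Fin n → Fin n → Set
    Meets z s = (z ≡ c × s ≡ d) ⊎ (z ≡ s × s ∈ Y)

    meets-injective : ∀ {z s z' s'} → Meets z s → Meets z' s' → z ≡ z' → s ≡ s'
    meets-injective (inj₁ (_ , s≡d))    (inj₁ (_ , s'≡d))    _ = trans s≡d (sym s'≡d)
    meets-injective (inj₁ (z≡c , _))    (inj₂ (z'≡s' , s'∈Y)) refl = ⊥-elim (c∉Y (subst (_∈ Y) (trans (sym z'≡s') z≡c) s'∈Y))
    meets-injective (inj₂ (z≡s , s∈Y))  (inj₁ (z'≡c , _))    refl = ⊥-elim (c∉Y (subst (_∈ Y) (trans (sym z≡s) z'≡c) s∈Y))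
    meets-injective (inj₂ (z≡s , _))    (inj₂ (z'≡s' , _))   refl = trans (sym z≡s) z'≡s'

    spliced-walk : ∀ {p q v} → EntersYc p → LeavesYd q → v ∈ˡ routeVertices p → v ∈ˡ routeVertices q → v ∉ Y → ⊥
    spliced-walk {route p} {route q} (a∈A , _ , p-clear) (_ , b∈B , q-clear) v∈p v∈q v∉Y with splice p q v∈p v∈q
    ... | w , w⊆ = sepY a∈A b∈B w (All-resp-⊆ w⊆ (All-++⁺ (Avoids-∪ p-clear) (v∉Y ∷ Avoids-∪ q-clear)))

    crossing : ∀ {p q v} → EntersYc p → LeavesYd q → v ∈ˡ routeVertices p → v ∈ˡ routeVertices q → Meets (target p) (source q)
    crossing {route p} {route q} ep@(_ , z∈Yc , p-clear) lq@(s∈Yd , _ , q-clear) v∈p v∈q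
      with ∈-vertices⇒target⊎init p v∈p | ∈-vertices⇒source⊎tail q v∈q
    ... | inj₂ v∈init | _ = ⊥-elim (spliced-walk ep lq v∈p v∈q (All.lookup (Avoids-∪ p-clear) v∈init))
    ... | inj₁ _ | inj₂ v∈tail = ⊥-elim (spliced-walk ep lq v∈p v∈q (All.lookup (Avoids-∪ q-clear) v∈tail))
    ... | inj₁ refl | inj₁ v≡s with ∈Y∪⁅⁆ s∈Yd | ∈Y∪⁅⁆ z∈Yc
    ...   | inj₁ s∈Y | _         = inj₂ (v≡s , s∈Y)
    ...   | inj₂ s≡d | inj₁ v∈Y  = ⊥-elim (d∉Y (subst (_∈ Y) (trans v≡s s≡d) v∈Y))
    ...   | inj₂ s≡d | inj₂ v≡c  = ⊥-elim (c≢d (trans (sym v≡c) (trans v≡s s≡d)))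

    lift : ∀ {a b} → Walk G⁻ a b → Walk G a b
    lift = weaken there

    ∈-lift⁻ : ∀ {a b v} (w : Walk G⁻ a b) → v ∈ˡ vertices (lift w) → v ∈ˡ vertices w
    ∈-lift⁻ w = subst (_ ∈ˡ_) (vertices-weaken there w)

    ∈-init-lift⁻ : ∀ {a b v} (w : Walk G⁻ a b) → v ∈ˡ initVertices (lift w) → v ∈ˡ vertices w
    ∈-init-lift⁻ w = ∈-lift⁻ w ∘ Sublist.lookup (initVertices⊆ (lift w))

    glue : ∀ {p q} → Meets (target p) (source q) →
           Σ (Walk G (source p) (target q)) λ w → ∀ {v} → v ∈ˡ vertices w → v ∈ˡ routeVertices p ⊎ v ∈ˡ routeVertices q
    glue {route {a} p} {route {_} {b} q} (inj₂ (z≡s , _)) = w , covered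
      where
        w : Walk G a b
        w = join (lift p) z≡s (lift q)
        covered : ∀ {v} → v ∈ˡ vertices w → v ∈ˡ vertices p ⊎ v ∈ˡ vertices q
        covered v∈ = map-⊎ (∈-init-lift⁻ p) (∈-lift⁻ q) (∈-join⁻ (lift p) z≡s (lift q) v∈)
    glue {route {a} p} {route {_} {b} q} (inj₁ (z≡c , s≡d)) = w , covered
      where
        w : Walk G a b
        w = join (lift p) z≡c (_ ∷⟨ subst (G c) (sym s≡d) cd ⟩ lift q)
        covered : ∀ {v} → v ∈ˡ vertices w → v ∈ˡ vertices p ⊎ v ∈ˡ vertices q
        covered v∈ with ∈-join⁻ (lift p) z≡c (_ ∷⟨ subst (G c) (sym s≡d) cd ⟩ lift q) v∈
        ... | inj₁ v∈p         = inj₁ (∈-init-lift⁻ p v∈p)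
        ... | inj₂ (here refl) = inj₁ (subst (_∈ˡ vertices p) z≡c (target∈ p))
        ... | inj₂ (there v∈q) = inj₂ (∈-lift⁻ q v∈q)

    module _ (ps : List (Route G⁻)) (ps-enter : All EntersYc ps) (ps-disjoint : AllPairs DisjointRoutes ps)
             (ps-many : ∣ Y ∣ < length ps) where

      targets-cover : ∀ {t} → t ∈ Yc → Σ (Route G⁻) λ p → p ∈ˡ ps × t ≡ target p
      targets-cover t∈Yc = ∈-map⁻ target (long-unique-covers (map target ps) Yc targets-unique targets-in
                             (ℕ.≤-trans (∣p∪⁅x⁆∣≤1+∣p∣ Y c) (subst (_ ≤_) (sym (length-map target ps)) ps-many)) t∈Yc)
        where
          targets-unique : Unique (map target ps)
          targets-unique = AllPairs-map⁺ (AllPairs.map DisjointRoutes⇒target≢ ps-disjoint)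
          targets-in : All (_∈ Yc) (map target ps)
          targets-in = All-map⁺ (All.map (λ (_ , t∈ , _) → t∈) ps-enter)

      partner : ∀ {q} → LeavesYd q → Σ (Route G⁻) λ p → p ∈ˡ ps × Meets (target p) (source q)
      partner {q} (s∈Yd , _) with ∈Y∪⁅⁆ s∈Yd
      ... | inj₁ s∈Y with targets-cover (x∈p∪q⁺ (inj₁ s∈Y))
      ...   | p , p∈ps , s≡t = p , p∈ps , inj₂ (sym s≡t , s∈Y)
      partner {q} (s∈Yd , _) | inj₂ s≡d with targets-cover (x∈p∪q⁺ (inj₂ (x∈⁅x⁆ c)))
      ...   | p , p∈ps , c≡t = p , p∈ps , inj₁ (sym c≡t , s≡d)

      record Glued (r : Route G) (q : Route G⁻) : Set where
        constructor glued
        field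
          {mate}  : Route G⁻
          mate∈   : mate ∈ˡ ps
          leaves  : LeavesYd q
          meets   : Meets (target mate) (source q)
          covered : ∀ {v} → v ∈ˡ routeVertices r → v ∈ˡ routeVertices mate ⊎ v ∈ˡ routeVertices q

      glue-to-partner : ∀ q → LeavesYd q → Σ (Route G) λ r → (source r ∈ A × target r ∈ B) × Glued r q
      glue-to-partner q lq@(_ , b∈B , _) with partner {q} lq
      ... | p , p∈ps , meets with glue meets
      ...   | w , covered = route w , (proj₁ (All.lookup ps-enter p∈ps) , b∈B) , glued p∈ps lq meets covered

      glued-disjoint : ∀ {q q' r r'} → Glued r q → Glued r' q' → DisjointRoutes q q' → DisjointRoutes r r'
      glued-disjoint (glued {p} p∈ lq m cov) (glued {p'} p'∈ lq' m' cov') dqq' v v∈r v∈r' with cov v∈r | cov' v∈r'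
      ... | inj₂ v∈q | inj₂ v∈q' = dqq' v v∈q v∈q'
      ... | inj₁ v∈p | inj₂ v∈q' =
        DisjointRoutes⇒source≢ dqq' (meets-injective m (crossing (All.lookup ps-enter p∈) lq' v∈p v∈q') refl)
      ... | inj₂ v∈q | inj₁ v∈p' =
        DisjointRoutes⇒source≢ dqq' (meets-injective (crossing (All.lookup ps-enter p'∈) lq v∈p' v∈q) m' refl)
      ... | inj₁ v∈p | inj₁ v∈p' = AllPairs-lookup DisjointRoutes-sym ps-disjoint p∈ p'∈ p≢p' v v∈p v∈p'
        where
          p≢p' : p ≢ p'
          p≢p' refl = DisjointRoutes⇒source≢ dqq' (meets-injective m m' refl)

    enter : (p : Route G⁻) → source p ∈ A × target p ∈ Yc → Σ (Route G⁻) λ p' → EntersYc p' × p' ≼ p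
    enter (route p) (a∈A , t∈Yc) with firstHit (_∈? Yc) p (lose (target∈ p) t∈Yc)
    ... | _ , z∈Yc , p' , clear , p'⊆p = route p' , (a∈A , z∈Yc , clear) , p'⊆p

    leave : (q : Route G⁻) → source q ∈ Yd × target q ∈ B → Σ (Route G⁻) λ q' → LeavesYd q' × q' ≼ q
    leave (route q) (s∈Yd , b∈B) with lastHit (_∈? Yd) q (lose (source∈ q) s∈Yd)
    ... | _ , z∈Yd , q' , clear , q'⊆q = route q' , (z∈Yd , b∈B , clear) , q'⊆q

    linkage-through : ∀ {k} → ∣ Y ∣ < k → Linkage G⁻ A Yc k → Linkage G⁻ Yd B k → Linkage G A B k
    linkage-through ∣Y∣<k (linkage ps ps-ends ps-disjoint ps-size) (linkage qs qs-ends qs-disjoint qs-size)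
      with refine enter ps-ends ps-disjoint | refine leave qs-ends qs-disjoint
    ... | ps' , ps'-enter , ps'-disjoint , ps'-len | qs' , qs'-leave , qs'-disjoint , qs'-len
      with pointwise-choice (glue-to-partner ps' ps'-enter ps'-disjoint (ℕ.<-≤-trans ∣Y∣<k (subst (_ ≤_) (sym ps'-len) ps-size))) qs'-leave
    ... | rs , rs-ends , rs-glued =
      linkage rs rs-ends (AllPairs-pointwise (glued-disjoint ps' ps'-enter ps'-disjoint _) rs-glued qs'-disjoint)
              (subst (_ ≤_) (sym (trans (Pointwise-length rs-glued) qs'-len)) qs-size)

  reroute : ∀ {A B Y k a b c d} → Separates G⁻ A B Y → ∣ Y ∣ < k → Endpoint c → Endpoint d → a ∈ A → b ∈ B →
            (w₁ : Walk G⁻ a c) → Avoids Y (vertices w₁) → (w₂ : Walk G⁻ d b) → Avoids Y (vertices w₂) → Menger G A B k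
  reroute {A} {B} {Y} {k} {c = c} {d} sepY ∣Y∣<k c-end d-end a∈A b∈B w₁ avoid₁ w₂ avoid₂ with c ≟ᶠ d
  ... | yes c≡d = ⊥-elim (sepY a∈A b∈B (join w₁ c≡d w₂) (All-join w₁ c≡d w₂ (All-resp-⊆ (initVertices⊆ w₁) avoid₁) avoid₂))
  ... | no c≢d with menger-L A (Y ∪ ⁅ c ⁆) k | menger-L (Y ∪ ⁅ d ⁆) B k
  ...   | inj₁ (separator T sepT small) | _ = inj₁ (separator T (separates-via-c w₂ b∈B avoid₂ sepT) small)
    where open Detour A B Y sepY (other-endpoint c-end d-end c≢d)
  ...   | inj₂ _ | inj₁ (separator T sepT small) = inj₁ (separator T (separates-via-d w₁ a∈A avoid₁ sepT) small)
    where open Detour A B Y sepY (other-endpoint c-end d-end c≢d)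
  ...   | inj₂ P | inj₂ Q = inj₂ (linkage-through ∣Y∣<k P Q)
    where open Splice A B Y sepY (All.lookup avoid₁ (target∈ w₁)) (All.lookup avoid₂ (source∈ w₂)) c≢d (endpoints-adjacent c-end d-end c≢d)

  menger-step : ∀ A B k → Menger G A B k
  menger-step A B k with menger-L A B k
  ... | inj₂ P = inj₂ (Linkage-weaken there P)
  ... | inj₁ (separator Y sepY ∣Y∣<k) with any? (λ a → (a ∈? A) ×-dec reachesAvoiding? (edges? _) Y B a)
  ...   | no ¬reach = inj₁ (separator Y (λ a∈A b∈B w avoid → ¬reach (_ , a∈A , _ , b∈B , w , avoid)) ∣Y∣<k)
  ...   | yes (a , a∈A , b , b∈B , w , avoid) with Any.any? endpoint? (vertices w)
  ...     | no ¬hit = ⊥-elim (edge-free sepY a∈A b∈B w (All-resp-⊆ (initVertices⊆ w) (¬Any⇒All¬ _ ¬hit)) avoid)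
  ...     | yes hit with firstHit endpoint? w hit | lastHit endpoint? w hit
  ...       | c , c-end , w₁ , clear₁ , w₁⊆w | d , d-end , w₂ , clear₂ , w₂⊆w with dropEdgeᴵ w₁ clear₁ | dropEdgeᵀ w₂ clear₂
  ...         | w₁' , same₁ , _ | w₂' , same₂ , _ =
    reroute sepY ∣Y∣<k c-end d-end a∈A b∈B w₁' (subst (Avoids Y) (sym same₁) (All-resp-⊆ w₁⊆w avoid))
                                          w₂' (subst (Avoids Y) (sym same₂) (All-resp-⊆ w₂⊆w avoid))

menger-edges : ∀ {n} (L : List (Fin n × Fin n)) A B k → Menger (Edges L) A B k
menger-edges []            = menger-edgeless
menger-edges ((x , y) ∷ L) = MengerStep.menger-step x y L (menger-edges L)

module _ {n : ℕ} {R : Rel (Fin n) 0ℓ} (R? : ∀ i j → Dec (R i j)) (R-sym : Symmetric R) where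

  edgeList : List (Fin n × Fin n)
  edgeList = filter (λ (i , j) → R? i j) (cartesianProduct (allFin n) (allFin n))

  R⇒Edges : R ⇒ Edges edgeList
  R⇒Edges {i} {j} r = Any.map (λ { refl → inj₁ (refl , refl) })
    (∈-filter⁺ (λ (i , j) → R? i j) (∈-cartesianProduct⁺ (∈-allFin i) (∈-allFin j)) r)

  Edges⇒R : Edges edgeList ⇒ R
  Edges⇒R joins with find joins
  ... | (x , y) , e∈ , i-j with ∈-filter⁻ (λ (i , j) → R? i j) {xs = cartesianProduct (allFin n) (allFin n)} e∈
  ...   | _ , r with i-j
  ...     | inj₁ (refl , refl) = r
  ...     | inj₂ (refl , refl) = R-sym r

  menger : ∀ A B k → Menger R A B k
  menger A B k with menger-edges edgeList A B k
  ... | inj₁ (separator S sep small) = inj₁ (separator S (Separates-weaken R⇒Edges sep) small)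
  ... | inj₂ P                       = inj₂ (Linkage-weaken Edges⇒R P)

-- The fan at an edge

module _ {n : ℕ} (G : Graph n) where

  walk-IsABPath : ∀ {A B : Fin n → Set} {a b} (w : Walk (Adj G) a b) → Unique (vertices w) → A a → B b →
                  (∀ z → z ∈ˡ vertices w → A z ⊎ B z → z ≡ a ⊎ z ≡ b) → IsABPath G A B (vertices w)
  walk-IsABPath     [ a ]        u a∈A b∈B ends = ([-] , u) , inj₁ (a∈A , b∈B) , ends
  walk-IsABPath {B = B} w@(a ∷⟨ _ ⟩ _) u a∈A b∈B ends =
    (Linked-vertices w , u) , inj₁ (a∈A , subst B (sym (endL-tailVertices w)) b∈B) ,
    λ z z∈ z∈A∪B → map₂ (λ z≡b → trans z≡b (sym (endL-tailVertices w))) (ends z z∈ z∈A∪B)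

  path-walk : ∀ {a b} xs → IsPathFromTo G a b xs → Σ (Walk (Adj G) a b) λ w → vertices w ≡ xs
  path-walk (a ∷ xs) ((linked , _) , refl , refl) = go a xs linked
    where
      go : ∀ a xs → Linked (Adj G) (a ∷ xs) → Σ (Walk (Adj G) a (endL a xs)) λ w → vertices w ≡ a ∷ xs
      go a []       _            = [ a ] , refl
      go a (b ∷ xs) (r ∷ linked) with go b xs linked
      ... | w , same = a ∷⟨ r ⟩ w , cong (a ∷_) same

module _ {n : ℕ} {R : Rel (Fin n) 0ℓ} (A B : Subset n) where

  record IsABRoute (p : Route R) : Set where
    field
      unique      : Unique (routeVertices p)
      source∈A    : source p ∈ A
      target∈B    : target p ∈ B
      only-source : ∀ {z} → z ∈ˡ routeVertices p → z ∈ A → z ≡ source p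
      only-target : ∀ {z} → z ∈ˡ routeVertices p → z ∈ B → z ≡ target p

  trim : (p : Route R) → source p ∈ A × target p ∈ B → Σ (Route R) λ p' → IsABRoute p' × p' ≼ p
  trim (route w) (a∈A , b∈B) with shortcut w
  ... | w₀ , u₀ , w₀⊆w with firstHit (_∈? B) w₀ (lose (target∈ w₀) b∈B)
  ...   | z , z∈B , w₁ , clear₁ , w₁⊆w₀ with lastHit (_∈? A) w₁ (lose (source∈ w₁) a∈A)
  ...     | s , s∈A , w₂ , clear₂ , w₂⊆w₁ = route w₂ , is-AB , ⊆-trans w₂⊆w₁ (⊆-trans w₁⊆w₀ w₀⊆w)
    where
      is-AB : IsABRoute (route w₂)
      is-AB = record
        { unique      = Unique-resp-⊇ (⊆-trans w₂⊆w₁ w₁⊆w₀) u₀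
        ; source∈A    = s∈A
        ; target∈B    = z∈B
        ; only-source = λ z∈ z∈A → case-source (∈-vertices⇒source⊎tail w₂ z∈) z∈A
        ; only-target = λ z∈ z∈B → case-target (∈-vertices⇒target⊎init w₁ (Sublist.lookup w₂⊆w₁ z∈)) z∈B
        }
        where
          case-source : ∀ {y} → y ≡ s ⊎ y ∈ˡ tailVertices w₂ → y ∈ A → y ≡ s
          case-source (inj₁ y≡s) _   = y≡s
          case-source (inj₂ y∈) y∈A = ⊥-elim (All.lookup clear₂ y∈ y∈A)
          case-target : ∀ {y} → y ≡ z ⊎ y ∈ˡ initVertices w₁ → y ∈ B → y ≡ z
          case-target (inj₁ y≡z) _   = y≡z
          case-target (inj₂ y∈) y∈B = ⊥-elim (All.lookup clear₁ y∈ y∈B)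

x∉p-x : ∀ {n} (p : Subset n) (x : Fin n) → x ∉ p - x
x∉p-x (_ ∷ᵛ p) zero    ()
x∉p-x (_ ∷ᵛ p) (suc x) x∈ = x∉p-x p x (drop-there x∈)

-- Vertex zero is the twin of u; it is not adjacent to suc u, as Adj H u u is false.
module Twin {n : ℕ} (H : Graph n) (u : Fin n) where

  collapse : Fin (suc n) → Fin n
  collapse zero    = u
  collapse (suc i) = i

  TwinAdj : Rel (Fin (suc n)) 0ℓ
  TwinAdj i j = Adj H (collapse i) (collapse j)

  twinAdj? : ∀ i j → Dec (TwinAdj i j)
  twinAdj? i j = adj H (collapse i) (collapse j) ≟ᵇ true

  twinAdj-sym : Symmetric TwinAdj
  twinAdj-sym {i} {j} r = trans (adj-sym H (collapse j) (collapse i)) r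

  collapse-merges : ∀ a b → collapse a ≡ collapse b → a ≡ b ⊎ (a ≡ zero × b ≡ suc u) ⊎ (a ≡ suc u × b ≡ zero)
  collapse-merges zero    zero    _    = inj₁ refl
  collapse-merges zero    (suc b) refl = inj₂ (inj₁ (refl , refl))
  collapse-merges (suc a) zero    refl = inj₂ (inj₂ (refl , refl))
  collapse-merges (suc a) (suc b) refl = inj₁ refl

  redirect : Fin n → Fin (suc n)
  redirect i with i ≟ᶠ u
  ... | yes _ = zero
  ... | no  _ = suc i

  redirect-cases : ∀ i → (i ≡ u × redirect i ≡ zero) ⊎ (i ≢ u × redirect i ≡ suc i)
  redirect-cases i with i ≟ᶠ u
  ... | yes i≡u = inj₁ (i≡u , refl)
  ... | no  i≢u = inj₂ (i≢u , refl)

  collapse-redirect : ∀ i → collapse (redirect i) ≡ i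
  collapse-redirect i with redirect-cases i
  ... | inj₁ (i≡u , eq) rewrite eq = sym i≡u
  ... | inj₂ (_ , eq)   rewrite eq = refl

  sucᵂ : ∀ {a b} → Walk (Adj H) a b → Walk TwinAdj (suc a) (suc b)
  sucᵂ = mapᵂ suc id

  redirectᵂ : ∀ {a b} → Walk (Adj H) a b → Walk TwinAdj (redirect a) (redirect b)
  redirectᵂ = mapᵂ redirect λ {i} {j} → subst₂ (Adj H) (sym (collapse-redirect i)) (sym (collapse-redirect j))

  collapseᵂ : ∀ {a b} → Walk TwinAdj a b → Walk (Adj H) (collapse a) (collapse b)
  collapseᵂ = mapᵂ collapse id

  collapsed : Route TwinAdj → List (Fin n)
  collapsed r = vertices (collapseᵂ (walk r))

  ∈-collapsed⁻ : ∀ {w} (r : Route TwinAdj) → w ∈ˡ collapsed r → Σ (Fin (suc n)) λ a → a ∈ˡ routeVertices r × w ≡ collapse a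
  ∈-collapsed⁻ (route r) w∈ = ∈-map⁻ collapse (subst (_ ∈ˡ_) (vertices-mapᵂ collapse id r) w∈)

  ∈-collapsed⁺ : ∀ {a} (r : Route TwinAdj) → a ∈ˡ routeVertices r → collapse a ∈ˡ collapsed r
  ∈-collapsed⁺ (route r) a∈ = subst (_ ∈ˡ_) (sym (vertices-mapᵂ collapse id r)) (∈-map⁺ collapse a∈)

  collapsed-disjoint : ∀ {r q} → DisjointRoutes r q → zero ∉ˡ routeVertices q → suc u ∉ˡ routeVertices q →
                       Disjoint (collapsed r) (collapsed q)
  collapsed-disjoint {r} {q} disjoint zero∉q su∉q w w∈r w∈q with ∈-collapsed⁻ r w∈r | ∈-collapsed⁻ q w∈q
  ... | a , a∈r , refl | b , b∈q , same with collapse-merges a b same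
  ...   | inj₁ refl                 = disjoint a a∈r b∈q
  ...   | inj₂ (inj₁ (_ , refl))    = su∉q b∈q
  ...   | inj₂ (inj₂ (_ , refl))    = zero∉q b∈q

  collapsed-meet : ∀ {r q} → DisjointRoutes r q → ∀ w → w ∈ˡ collapsed r → w ∈ˡ collapsed q → w ≡ u
  collapsed-meet {r} {q} disjoint w w∈r w∈q with ∈-collapsed⁻ r w∈r | ∈-collapsed⁻ q w∈q
  ... | a , a∈r , refl | b , b∈q , same with collapse-merges a b same
  ...   | inj₁ refl                 = ⊥-elim (disjoint a a∈r b∈q)
  ...   | inj₂ (inj₁ (refl , _))    = refl
  ...   | inj₂ (inj₂ (refl , _))    = refl

module FanAtEdge {n : ℕ} (H : Graph n) (connected : KConnected 3 H) (u v : Fin n) (uv : Adj H u v)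
                 (X : Subset n) (u∉X : u ∉ X) (v∉X : v ∉ X) (∣X∣≥3 : 3 ≤ ∣ X ∣) where
  open Twin H u

  X' Ends : Subset (suc n)
  X'   = outside ∷ᵛ X
  Ends = inside ∷ᵛ (⁅ u ⁆ ∪ ⁅ v ⁆)

  X'-collapse : ∀ {i} → i ∈ X' → collapse i ∈ X
  X'-collapse {suc i} i∈ = drop-there i∈

  collapse-X' : ∀ i → collapse i ∈ X → i ∈ X'
  collapse-X' zero    u∈X = ⊥-elim (u∉X u∈X)
  collapse-X' (suc i) i∈X = V.there i∈X

  Ends-collapse : ∀ {i} → i ∈ Ends → Pair u v (collapse i)
  Ends-collapse {zero}  _  = inj₁ refl
  Ends-collapse {suc i} i∈ = map-⊎ (x∈⁅y⁆⇒x≡y u) (x∈⁅y⁆⇒x≡y v) (x∈p∪q⁻ ⁅ u ⁆ ⁅ v ⁆ (drop-there i∈))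

  collapse-Ends : ∀ i → Pair u v (collapse i) → i ∈ Ends
  collapse-Ends zero    _           = V.here
  collapse-Ends (suc i) (inj₁ refl) = V.there (x∈p∪q⁺ (inj₁ (x∈⁅x⁆ u)))
  collapse-Ends (suc i) (inj₂ refl) = V.there (x∈p∪q⁺ (inj₂ (x∈⁅x⁆ v)))

  collapsed-IsABPath : ∀ {r} → IsABRoute X' Ends r → ¬ (zero ∈ˡ routeVertices r × suc u ∈ˡ routeVertices r) →
                       IsABPath H (InSet X) (Pair u v) (collapsed r)
  collapsed-IsABPath {route {s} {t} r} ab not-both =
    walk-IsABPath H (collapseᵂ r) collapsed-unique (X'-collapse source∈A) (Ends-collapse target∈B) ends
    where
      open IsABRoute ab
      injective : ∀ {a b} → a ∈ˡ vertices r → b ∈ˡ vertices r → collapse a ≡ collapse b → a ≡ b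
      injective {a} {b} a∈ b∈ same with collapse-merges a b same
      ... | inj₁ a≡b                 = a≡b
      ... | inj₂ (inj₁ (refl , refl)) = ⊥-elim (not-both (a∈ , b∈))
      ... | inj₂ (inj₂ (refl , refl)) = ⊥-elim (not-both (b∈ , a∈))
      collapsed-unique : Unique (vertices (collapseᵂ r))
      collapsed-unique = subst Unique (sym (vertices-mapᵂ collapse id r)) (Unique-map⁺-on collapse injective unique)
      ends : ∀ z → z ∈ˡ vertices (collapseᵂ r) → InSet X z ⊎ Pair u v z → z ≡ collapse s ⊎ z ≡ collapse t
      ends z z∈ with ∈-collapsed⁻ (route r) z∈
      ... | a , a∈ , refl = map-⊎ (cong collapse ∘ only-source a∈ ∘ collapse-X' a) (cong collapse ∘ only-target a∈ ∘ collapse-Ends a)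

  u≢v : u ≢ v
  u≢v refl with trans (sym uv) (irrefl H u)
  ... | ()

  walk-avoiding : ∀ S → ∣ S ∣ < 3 → ∀ {a b} → a ∉ S → b ∉ S → Σ (Walk (Adj H) a b) λ w → Avoids S (vertices w)
  walk-avoiding S small a∉S b∉S with proj₂ (proj₂ connected S small) _ _ a∉S b∉S
  ... | xs , is-path , avoid with path-walk H xs is-path
  ...   | w , same = w , subst (Avoids S) (sym same) avoid

  Avoids-map-suc : ∀ {b} {S : Subset n} {xs} → Avoids S xs → Avoids (b ∷ᵛ S) (map suc xs)
  Avoids-map-suc avoid = All-map⁺ (All.map (_∘ drop-there) avoid)

  no-small-separator : (S' : Subset (suc n)) → Separates TwinAdj X' Ends S' → ¬ ∣ S' ∣ < 3
  no-small-separator (inside ∷ᵛ S) sep (s≤s ∣S∣<2) with ∃-∈-∉ X S (ℕ.<-≤-trans (ℕ.m<n⇒m<1+n ∣S∣<2) ∣X∣≥3)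
  ... | x₀ , x₀∈X , x₀∉S with end-outside
    where
      end-outside : Σ (Fin n) λ t → t ∈ ⁅ u ⁆ ∪ ⁅ v ⁆ × t ∉ S
      end-outside with u ∈? S | v ∈? S
      ... | no u∉S  | _       = u , x∈p∪q⁺ (inj₁ (x∈⁅x⁆ u)) , u∉S
      ... | yes _   | no v∉S  = v , x∈p∪q⁺ (inj₂ (x∈⁅x⁆ v)) , v∉S
      ... | yes u∈S | yes v∈S = ⊥-elim (ℕ.<⇒≱ ∣S∣<2 (2≤∣p∣ u∈S v∈S u≢v))
  ...   | t , t∈uv , t∉S with walk-avoiding S (ℕ.m<n⇒m<1+n ∣S∣<2) x₀∉S t∉S
  ...     | w , avoid = sep (V.there x₀∈X) (V.there t∈uv) (sucᵂ w)
                          (subst (Avoids _) (sym (vertices-mapᵂ suc id w)) (Avoids-map-suc avoid))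
  no-small-separator (outside ∷ᵛ S) sep ∣S∣<3 with ∃-∈-∉ X S (ℕ.<-≤-trans ∣S∣<3 ∣X∣≥3)
  ... | x₀ , x₀∈X , x₀∉S
    with walk-avoiding (S - u) (ℕ.≤-<-trans (∣p─q∣≤∣p∣ S ⁅ u ⁆) ∣S∣<3) (x₀∉S ∘ p─q⊆p S ⁅ u ⁆) (x∉p-x S u)
  ...   | w , avoid = sep (redirect-X x₀∈X) redirect-u (redirectᵂ w)
                        (subst (Avoids _) (sym (vertices-mapᵂ redirect _ w)) (All-map⁺ (All.map avoids-redirect avoid)))
    where
      redirect-X : ∀ {i} → i ∈ X → redirect i ∈ X'
      redirect-X {i} i∈X with redirect-cases i
      ... | inj₁ (refl , _)  = ⊥-elim (u∉X i∈X)
      ... | inj₂ (_ , same) = subst (_∈ X') (sym same) (V.there i∈X)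
      redirect-u : redirect u ∈ Ends
      redirect-u with redirect-cases u
      ... | inj₁ (_ , same)   = subst (_∈ Ends) (sym same) V.here
      ... | inj₂ (u≢u , _)    = ⊥-elim (u≢u refl)
      avoids-redirect : ∀ {i} → i ∉ S - u → redirect i ∉ outside ∷ᵛ S
      avoids-redirect {i} i∉S-u with redirect-cases i
      ... | inj₁ (_ , same)   = λ zero∈ → case-zero (subst (_∈ outside ∷ᵛ S) same zero∈)
        where
          case-zero : zero ∉ outside ∷ᵛ S
          case-zero ()
      ... | inj₂ (i≢u , same) = λ i∈ → i∉S-u (x∈p∧x≢y⇒x∈p-y (drop-there (subst (_∈ outside ∷ᵛ S) same i∈)) i≢u)

  EdgeFan : Set
  EdgeFan = Σ (Fin n) λ x → (x ≡ u ⊎ x ≡ v) ×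
      Σ (List (Fin n)) λ α → Σ (List (Fin n)) λ β → Σ (List (Fin n)) λ γ →
        IsABPath H (InSet X) (Pair u v) α ×
        IsABPath H (InSet X) (Pair u v) β ×
        IsABPath H (InSet X) (Pair u v) γ ×
        Disjoint α γ × Disjoint β γ × MeetExactlyAt α β x

  collapse-fan : ∀ {r₀ rᵤ rᵥ} → IsABRoute X' Ends r₀ → IsABRoute X' Ends rᵤ → IsABRoute X' Ends rᵥ →
                 zero ∈ˡ routeVertices r₀ → suc u ∈ˡ routeVertices rᵤ →
                 DisjointRoutes r₀ rᵤ → DisjointRoutes r₀ rᵥ → DisjointRoutes rᵤ rᵥ → EdgeFan
  collapse-fan {r₀} {rᵤ} {rᵥ} ab₀ abᵤ abᵥ zero∈r₀ u∈rᵤ d₀ᵤ d₀ᵥ dᵤᵥ =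
    u , inj₁ refl , collapsed r₀ , collapsed rᵤ , collapsed rᵥ ,
    collapsed-IsABPath ab₀ (λ (_ , u∈r₀) → d₀ᵤ _ u∈r₀ u∈rᵤ) ,
    collapsed-IsABPath abᵤ (λ (zero∈rᵤ , _) → d₀ᵤ _ zero∈r₀ zero∈rᵤ) ,
    collapsed-IsABPath abᵥ (λ (zero∈rᵥ , _) → zero∉rᵥ zero∈rᵥ) ,
    collapsed-disjoint d₀ᵥ zero∉rᵥ u∉rᵥ , collapsed-disjoint dᵤᵥ zero∉rᵥ u∉rᵥ ,
    ∈-collapsed⁺ r₀ zero∈r₀ , ∈-collapsed⁺ rᵤ u∈rᵤ , collapsed-meet d₀ᵤ
    where
      zero∉rᵥ : zero ∉ˡ routeVertices rᵥ
      zero∉rᵥ = d₀ᵥ _ zero∈r₀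
      u∉rᵥ : suc u ∉ˡ routeVertices rᵥ
      u∉rᵥ = dᵤᵥ _ u∈rᵤ

  fan-from-routes : ∀ rs → All (IsABRoute X' Ends) rs → AllPairs DisjointRoutes rs → 3 ≤ length rs → EdgeFan
  fan-from-routes rs rs-AB rs-disjoint 3≤len
    with route-to V.here | route-to (V.there (x∈p∪q⁺ (inj₁ (x∈⁅x⁆ u)))) | route-to (V.there (x∈p∪q⁺ (inj₂ (x∈⁅x⁆ v))))
    where
      ∣Ends∣≤ : ∣ Ends ∣ ≤ length (map target rs)
      ∣Ends∣≤ = ℕ.≤-trans (s≤s (ℕ.≤-trans (∣p∪⁅x⁆∣≤1+∣p∣ ⁅ u ⁆ v) (ℕ.≤-reflexive (cong suc (∣⁅x⁆∣≡1 u)))))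
                  (subst (3 ≤_) (sym (length-map target rs)) 3≤len)
      route-to : ∀ {t} → t ∈ Ends → Σ (Route TwinAdj) λ r → r ∈ˡ rs × target r ≡ t
      route-to t∈ with ∈-map⁻ target (long-unique-covers (map target rs) Ends
                          (AllPairs-map⁺ (AllPairs.map DisjointRoutes⇒target≢ rs-disjoint))
                          (All-map⁺ (All.map IsABRoute.target∈B rs-AB)) ∣Ends∣≤ t∈)
      ... | r , r∈ , t≡ = r , r∈ , sym t≡
  ... | r₀ , r₀∈ , t₀ | rᵤ , rᵤ∈ , tᵤ | rᵥ , rᵥ∈ , tᵥ =
    collapse-fan (All.lookup rs-AB r₀∈) (All.lookup rs-AB rᵤ∈) (All.lookup rs-AB rᵥ∈) (ends-at r₀ t₀) (ends-at rᵤ tᵤ)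
                 (disjoint-members r₀∈ rᵤ∈ λ t≡t → 0≢1+n (trans (sym t₀) (trans t≡t tᵤ)))
                 (disjoint-members r₀∈ rᵥ∈ λ t≡t → 0≢1+n (trans (sym t₀) (trans t≡t tᵥ)))
                 (disjoint-members rᵤ∈ rᵥ∈ λ t≡t → u≢v (suc-injective (trans (sym tᵤ) (trans t≡t tᵥ))))
    where
      disjoint-members : ∀ {r r'} → r ∈ˡ rs → r' ∈ˡ rs → target r ≢ target r' → DisjointRoutes r r'
      disjoint-members r∈ r'∈ t≢t' = AllPairs-lookup DisjointRoutes-sym rs-disjoint r∈ r'∈ (t≢t' ∘ cong target)
      ends-at : ∀ (r : Route TwinAdj) {t} → target r ≡ t → t ∈ˡ routeVertices r
      ends-at (route r) refl = target∈ r

  fan : EdgeFan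
  fan with menger twinAdj? (λ {i} {j} → twinAdj-sym {i} {j}) X' Ends 3
  ... | inj₁ (separator S sep small) = ⊥-elim (no-small-separator S sep small)
  ... | inj₂ (linkage ps ends disjoint size) with refine (trim X' Ends) ends disjoint
  ...   | rs , rs-AB , rs-disjoint , len = fan-from-routes rs rs-AB rs-disjoint (subst (3 ≤_) (sym len) size)

lemma2p5 : ∀ {n} (H : Graph n) → KConnected 3 H →
    (u v : Fin n) → Adj H u v →
    (X : Subset n) → u ∉ X → v ∉ X → 3 ≤ ∣ X ∣ →
    Σ (Fin n) λ x → (x ≡ u ⊎ x ≡ v) ×
      Σ (List (Fin n)) λ α → Σ (List (Fin n)) λ β → Σ (List (Fin n)) λ γ →
        IsABPath H (InSet X) (Pair u v) α ×
        IsABPath H (InSet X) (Pair u v) β ×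
        IsABPath H (InSet X) (Pair u v) γ ×
        Disjoint α γ × Disjoint β γ × MeetExactlyAt α β x
lemma2p5 H connected u v uv X u∉X v∉X ∣X∣≥3 = FanAtEdge.fan H connected u v uv X u∉X v∉X ∣X∣≥3
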